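{- For every integer $k \geq 1$, with $n = 2k+1$, and every integer $i$ with $1 < i \leq k$, we have $\sigma(i, n) < \sigma(i-1, n)$, where $\sigma(j, n)$ is the number of $\sigma$-sequences of length $n$ with first term $a_1 = j$.
   Context: Let $k \geq 1$ and $n = 2k+1$. A $\sigma$-sequence of length $n$ is a sequence of integers $a_1 a_2 \dots a_n$ such that, with all indices taken cyclically modulo $n$: (i) $a_i \geq 0$; (ii) if $a_i = 0$ then $a_{i+(k+1)} = 1$; (iii) if $a_i = 1$ then $a_{i-1} = 0$ or $a_{i+k} = 0$; (iv) if $a_i > 1$ then $a_{i-1} = a_i - 1$; (v) there are at most three indices $i$ with $a_i = 0$. (Equivalently, every cyclic rotation of the sequence satisfies these conditions.) -}

module Defs where

open import Data.Nat using (ℕ; zero; suc; _+_; _*_; _∸_; _≤_; _<_; _>_; NonZero)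
open import Data.Nat.Properties using (_≟_; _≤?_; _<?_)
open import Data.Nat.DivMod using (_%_; m%n<n)
open import Data.Fin using (Fin; toℕ; fromℕ<)
open import Data.Fin.Properties using (all?)
open import Data.Vec using (Vec; []; _∷_; lookup; toList; head)
open import Data.List using (List; []; _∷_; length; filter; concatMap; map; upTo)
open import Data.Product using (_×_)
open import Data.Sum using (_⊎_)
open import Relation.Binary.PropositionalEquality using (_≡_)
open import Relation.Nullary using (Dec; _×-dec_; _⊎-dec_; _→-dec_)

-- Cyclic access: position p (a natural number) of a sequence of length
-- n = 2k+1 = suc (2 * k), taken modulo n.  Positions are 0-based, so
-- position 0 is the first term a_1.
at : ∀ {n} → Vec ℕ (suc n) → ℕ → ℕ
at {n} a p = lookup a (fromℕ< (m%n<n p (suc n)))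

len : ℕ → ℕ
len k = suc (2 * k)

zeros : ∀ {m} → Vec ℕ m → ℕ
zeros a = length (filter (_≟ 0) (toList a))

-- The σ-sequence conditions (i)–(v); (i) is automatic since entries are in ℕ.
-- Index i ranges over positions 0..n-1; i-1 is written i + 2k (≡ i + n - 1 mod n).
IsSigma : (k : ℕ) → Vec ℕ (len k) → Set
IsSigma k a =
  (∀ (i : Fin (len k)) →
     (at a (toℕ i) ≡ 0 → at a (toℕ i + (k + 1)) ≡ 1)
   × (at a (toℕ i) ≡ 1 → (at a (toℕ i + 2 * k) ≡ 0) ⊎ (at a (toℕ i + k) ≡ 0))
   × (at a (toℕ i) > 1 → at a (toℕ i + 2 * k) ≡ at a (toℕ i) ∸ 1))
  × zeros a ≤ 3

isSigma? : (k : ℕ) → (a : Vec ℕ (len k)) → Dec (IsSigma k a)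
isSigma? k a =
  all? (λ i →
        (at a (toℕ i) ≟ 0 →-dec at a (toℕ i + (k + 1)) ≟ 1)
   ×-dec (at a (toℕ i) ≟ 1 →-dec (at a (toℕ i + 2 * k) ≟ 0 ⊎-dec at a (toℕ i + k) ≟ 0))
   ×-dec (1 <? at a (toℕ i) →-dec at a (toℕ i + 2 * k) ≟ at a (toℕ i) ∸ 1))
  ×-dec (zeros a ≤? 3)

vecsBelow : (B m : ℕ) → List (Vec ℕ m)
vecsBelow B zero = [] ∷ []
vecsBelow B (suc m) = concatMap (λ x → map (x ∷_) (vecsBelow B m)) (upTo B)

-- Every entry of a σ-sequence of length n is ≤ n (an entry v > 1 forces the
-- v-1 preceding entries to be v-1, …, 1, all at distinct positions), so
-- enumerating entries in {0, …, n} counts all σ-sequences.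
sigmaCount : (j k : ℕ) → ℕ
sigmaCount j k =
  length (filter (λ a → isSigma? k a ×-dec (head a ≟ j))
                 (vecsBelow (suc (len k)) (len k)))

module Submission where

-- Rotating a sequence one step to the right, a₁ … aₙ ↦ aₙ a₁ … aₙ₋₁, preserves the
-- σ-conditions, and if a₁ = i > 1 then condition (iv) gives aₙ = i - 1.  So rotation
-- injects the σ-sequences with first term i into those with first term i - 1, and all
-- its images have second term i.  With i = c + 2 and k = c + d + 2 the σ-sequence
--   c+1, 1, 2, …, d+1, 0, 1, …, c, 0, 1, …, d+1, 1, 2, …, c
-- has first term i - 1 and second term 1, so it is missed and the inequality is strict.

open import Defs
open import Data.Nat using (ℕ; _≤_; _<_; _>_; _∸_; zero; suc; _+_; _*_; z≤n; s≤s; NonZero)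
open import Data.Nat.Properties
  using (module ≤-Reasoning; _≟_; +-suc; +-comm; +-identityʳ; +-commutativeSemigroup; suc-injective;
         ≤-trans; <-trans; <-asym; <-irrefl; >⇒≢; m≤m+n; m≤n+m; n≤1+n; n<1+n; m≤n⇒∃[o]m+o≡n)
open import Algebra.Properties.CommutativeSemigroup +-commutativeSemigroup using (xy∙z≈xz∙y)
open import Data.Nat.DivMod using (_%_; m%n<n; %-distribˡ-+; m%n%n≡m%n; [m+n]%n≡m%n; m<n⇒m%n≡m)
open import Data.Nat.Tactic.RingSolver using (solve-∀)
open import Data.Bool using (true; false)
open import Data.Fin as Fin using (Fin; toℕ; fromℕ<; fromℕ; inject₁)
open import Data.Fin.Properties
  using (toℕ-injective; toℕ-fromℕ<; toℕ-fromℕ; toℕ-inject₁; fromℕ<-cong; toℕ<n)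
open import Data.Vec
  using (Vec; []; _∷_; lookup; head; tail; init; last; initLast; _∷ʳ_; toList; tabulate)
open import Data.Vec.Properties using (∷-injective; toList-∷ʳ; lookup∘tabulate)
open import Data.Vec.Relation.Unary.All using (All; []; _∷_)
open import Data.Vec.Relation.Unary.All.Properties
  using (toList⁺; toList⁻) renaming (tabulate⁺ to All-tabulate⁺)
open import Data.List as List
  using (List; []; _∷_; length; filter; map; upTo; _++_; concatMap; cartesianProductWith)
open import Data.List.Properties using (length-map; length-removeAt′)
open import Data.List.Membership.Propositional using (_∈_; _∉_)
open import Data.List.Membership.Propositional.Properties
  using (∈-map⁻; ∈-filter⁺; ∈-filter⁻; ∈-upTo⁺; ∈-upTo⁻;
         ∈-cartesianProductWith⁺; ∈-cartesianProductWith⁻)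
open import Data.List.Relation.Binary.Subset.Propositional using (_⊆_)
open import Data.List.Relation.Binary.Permutation.Propositional
  using (_↭_; ↭-sym; ↭-reflexive; ↭-trans)
open import Data.List.Relation.Binary.Permutation.Propositional.Properties
  using (∷↭∷ʳ; ↭-length; filter-↭; All-resp-↭)
open import Data.List.Relation.Unary.Any using (here; there; index; _─_)
import Data.List.Relation.Unary.All as ListAll
open import Data.List.Relation.Unary.All.Properties using (¬Any⇒All¬)
open import Data.List.Relation.Unary.AllPairs using ([]; _∷_)
open import Data.List.Relation.Unary.Unique.Propositional using (Unique)
open import Data.List.Relation.Unary.Unique.Propositional.Properties
  using (map⁺; filter⁺; upTo⁺; tabulate⁺; cartesianProductWith⁺)
open import Data.Product using (_×_; _,_; proj₂)
open import Data.Sum using (_⊎_; inj₁; inj₂; [_,_]′) renaming (map to ⊎-map)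
open import Function using (_∘_)
open import Relation.Nullary using (yes; no; does; contradiction; _×-dec_)
open import Relation.Binary.PropositionalEquality

module _ {A : Set} where

  ∈-─⁺ : ∀ {x y : A} {ys} (x∈ys : x ∈ ys) → y ∈ ys → y ≢ x → y ∈ (ys ─ x∈ys)
  ∈-─⁺ (here refl)  (here refl)  y≢x = contradiction refl y≢x
  ∈-─⁺ (here refl)  (there y∈ys) _   = y∈ys
  ∈-─⁺ (there x∈ys) (here refl)  _   = here refl
  ∈-─⁺ (there x∈ys) (there y∈ys) y≢x = there (∈-─⁺ x∈ys y∈ys y≢x)

  Unique-⊆⇒length≤ : ∀ {xs ys : List A} → Unique xs → xs ⊆ ys → length xs ≤ length ys
  Unique-⊆⇒length≤ {[]}          _            _     = z≤n
  Unique-⊆⇒length≤ {x ∷ xs} {ys} (x∉xs ∷ xs!) xs⊆ys = begin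
    suc (length xs)          ≤⟨ s≤s (Unique-⊆⇒length≤ xs! xs⊆ys─x) ⟩
    suc (length (ys ─ x∈ys)) ≡⟨ length-removeAt′ ys (index x∈ys) ⟨
    length ys                ∎
    where
    open ≤-Reasoning
    x∈ys = xs⊆ys (here refl)
    xs⊆ys─x : xs ⊆ (ys ─ x∈ys)
    xs⊆ys─x y∈xs = ∈-─⁺ x∈ys (xs⊆ys (there y∈xs)) (≢-sym (ListAll.lookup x∉xs y∈xs))

length-<-injection : ∀ {A B : Set} {xs : List A} {ys : List B} {y} (f : A → B) →
                     (∀ {x x′} → f x ≡ f x′ → x ≡ x′) → Unique xs →
                     (∀ {x} → x ∈ xs → f x ∈ ys) →
                     y ∈ ys → (∀ {x} → x ∈ xs → f x ≢ y) →
                     length xs < length ys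
length-<-injection {xs = xs} {ys} {y} f f-injective xs! f∈ys y∈ys f≢y = begin
  suc (length xs)        ≡⟨ cong suc (length-map f xs) ⟨
  length (y ∷ map f xs)  ≤⟨ Unique-⊆⇒length≤ y∷fxs! y∷fxs⊆ys ⟩
  length ys              ∎
  where
  open ≤-Reasoning
  y∉fxs : y ∉ map f xs
  y∉fxs y∈fxs with x , x∈xs , refl ← ∈-map⁻ f y∈fxs = f≢y x∈xs refl
  y∷fxs! : Unique (y ∷ map f xs)
  y∷fxs! = ¬Any⇒All¬ (map f xs) y∉fxs ∷ map⁺ f-injective xs!
  y∷fxs⊆ys : (y ∷ map f xs) ⊆ ys
  y∷fxs⊆ys (here refl)   = y∈ys
  y∷fxs⊆ys (there z∈fxs) with x , x∈xs , refl ← ∈-map⁻ f z∈fxs = f∈ys x∈xs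

concatMap≡cartesianProductWith : ∀ {A B C : Set} (f : A → B → C) xs ys →
                                 concatMap (λ x → map (f x) ys) xs ≡ cartesianProductWith f xs ys
concatMap≡cartesianProductWith f []       ys = refl
concatMap≡cartesianProductWith f (x ∷ xs) ys =
  cong (map (f x) ys ++_) (concatMap≡cartesianProductWith f xs ys)

vecsBelow-suc : ∀ B m → vecsBelow B (suc m) ≡ cartesianProductWith _∷_ (upTo B) (vecsBelow B m)
vecsBelow-suc B m = concatMap≡cartesianProductWith _∷_ (upTo B) (vecsBelow B m)

vecsBelow-unique : ∀ B m → Unique (vecsBelow B m)
vecsBelow-unique B zero    = ListAll.[] ∷ []
vecsBelow-unique B (suc m) rewrite vecsBelow-suc B m =
  cartesianProductWith⁺ _∷_ ∷-injective (upTo⁺ B) (vecsBelow-unique B m)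

∈-vecsBelow⁺ : ∀ {B m} {a : Vec ℕ m} → All (_< B) a → a ∈ vecsBelow B m
∈-vecsBelow⁺ []                       = here refl
∈-vecsBelow⁺ {B} {suc m} (x<B ∷ xs<B) rewrite vecsBelow-suc B m =
  ∈-cartesianProductWith⁺ _∷_ (∈-upTo⁺ x<B) (∈-vecsBelow⁺ xs<B)

∈-vecsBelow⁻ : ∀ {B m} {a : Vec ℕ m} → a ∈ vecsBelow B m → All (_< B) a
∈-vecsBelow⁻ {a = []} _ = []
∈-vecsBelow⁻ {B} {suc m} {x ∷ xs} a∈ rewrite vecsBelow-suc B m
  with _ , _ , x∈ , xs∈ , refl ← ∈-cartesianProductWith⁻ _∷_ (upTo B) (vecsBelow B m) a∈ =
  ∈-upTo⁻ x∈ ∷ ∈-vecsBelow⁻ xs∈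

zeros-tabulate : ∀ {A : Set} {n} (h : A → ℕ) (f : Fin n → A) →
                 zeros (tabulate (h ∘ f)) ≡ length (filter (λ x → h x ≟ 0) (List.tabulate f))
zeros-tabulate {n = zero}  h f = refl
zeros-tabulate {n = suc n} h f with does (h (f Fin.zero) ≟ 0)
... | true  = cong suc (zeros-tabulate h (f ∘ Fin.suc))
... | false = zeros-tabulate h (f ∘ Fin.suc)

zeros-tabulate-≤ : ∀ {n} (h : ℕ → ℕ) (zs : List ℕ) → (∀ p → h p ≡ 0 → p ∈ zs) →
                   zeros (tabulate {n = n} (h ∘ toℕ)) ≤ length zs
zeros-tabulate-≤ {n} h zs h≡0⇒∈zs = begin
  zeros (tabulate {n = n} (h ∘ toℕ))  ≡⟨ zeros-tabulate {n = n} h toℕ ⟩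
  length zeroPositions                ≤⟨ Unique-⊆⇒length≤ zeroPositions! zeroPositions⊆zs ⟩
  length zs                           ∎
  where
  open ≤-Reasoning
  zeroPositions : List ℕ
  zeroPositions = filter (λ x → h x ≟ 0) (List.tabulate {n = n} toℕ)
  zeroPositions! : Unique zeroPositions
  zeroPositions! = filter⁺ (λ x → h x ≟ 0) (tabulate⁺ {f = toℕ {n}} toℕ-injective)
  zeroPositions⊆zs : zeroPositions ⊆ zs
  zeroPositions⊆zs p∈ =
    h≡0⇒∈zs _ (proj₂ (∈-filter⁻ (λ x → h x ≟ 0) {xs = List.tabulate {n = n} toℕ} p∈))

[m%n+o]%n≡[m+o]%n : ∀ m o n .{{_ : NonZero n}} → (m % n + o) % n ≡ (m + o) % n
[m%n+o]%n≡[m+o]%n m o n = begin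
  (m % n + o) % n          ≡⟨ %-distribˡ-+ (m % n) o n ⟩
  (m % n % n + o % n) % n  ≡⟨ cong (λ r → (r + o % n) % n) (m%n%n≡m%n m n) ⟩
  (m % n + o % n) % n      ≡⟨ %-distribˡ-+ m o n ⟨
  (m + o) % n              ∎
  where open ≡-Reasoning

module _ {m : ℕ} (a : Vec ℕ (suc m)) where

  at-cong : ∀ {p q} → p % suc m ≡ q % suc m → at a p ≡ at a q
  at-cong {p} {q} p≡q = cong (lookup a) (fromℕ<-cong _ _ p≡q (m%n<n p (suc m)) (m%n<n q (suc m)))

  at-toℕ : ∀ t → at a (toℕ t) ≡ lookup a t
  at-toℕ t = cong (lookup a) (toℕ-injective (trans (toℕ-fromℕ< _) (m<n⇒m%n≡m (toℕ<n t))))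

  at-%-+ : ∀ p o → at a (p % suc m + o) ≡ at a (p + o)
  at-%-+ p o = at-cong {p % suc m + o} {p + o} ([m%n+o]%n≡[m+o]%n p o (suc m))

  at-+-period : ∀ p → at a (p + suc m) ≡ at a p
  at-+-period p = at-cong {p + suc m} {p} ([m+n]%n≡m%n p (suc m))

lookup-init : ∀ {A : Set} {m} (a : Vec A (suc m)) (j : Fin m) →
              lookup (init a) j ≡ lookup a (inject₁ j)
lookup-init (x ∷ _ ∷ _)      Fin.zero    = refl
lookup-init (x ∷ xs@(_ ∷ _)) (Fin.suc j) = lookup-init xs j

last≡lookup-fromℕ : ∀ {A : Set} {m} (a : Vec A (suc m)) → last a ≡ lookup a (fromℕ m)
last≡lookup-fromℕ (x ∷ [])         = refl
last≡lookup-fromℕ (x ∷ xs@(_ ∷ _)) = last≡lookup-fromℕ xs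

head-init : ∀ {A : Set} {m} (a : Vec A (suc (suc m))) → head (init a) ≡ head a
head-init (x ∷ _ ∷ _) = refl

module _ {A : Set} {m : ℕ} where

  rotR : Vec A (suc m) → Vec A (suc m)
  rotR a = last a ∷ init a

  init-∷ʳ-last : (a : Vec A (suc m)) → init a ∷ʳ last a ≡ a
  init-∷ʳ-last a = sym (proj₂ (proj₂ (initLast a)))

  rotR-injective : ∀ {a b : Vec A (suc m)} → rotR a ≡ rotR b → a ≡ b
  rotR-injective {a} {b} eq with last≡ , init≡ ← ∷-injective eq = begin
    a                 ≡⟨ init-∷ʳ-last a ⟨
    init a ∷ʳ last a  ≡⟨ cong₂ _∷ʳ_ init≡ last≡ ⟩
    init b ∷ʳ last b  ≡⟨ init-∷ʳ-last b ⟩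
    b                 ∎
    where open ≡-Reasoning

  toList-rotR : (a : Vec A (suc m)) → toList (rotR a) ↭ toList a
  toList-rotR a = ↭-trans (∷↭∷ʳ (last a) (toList (init a)))
    (↭-reflexive (trans (sym (toList-∷ʳ (last a) (init a))) (cong toList (init-∷ʳ-last a))))

  All-rotR : ∀ {P : A → Set} {a : Vec A (suc m)} → All P a → All P (rotR a)
  All-rotR {a = a} = toList⁻ ∘ All-resp-↭ (↭-sym (toList-rotR a)) ∘ toList⁺

zeros-rotR : ∀ {m} (a : Vec ℕ (suc m)) → zeros (rotR a) ≡ zeros a
zeros-rotR a = ↭-length (filter-↭ (_≟ 0) (toList-rotR a))

module _ {m : ℕ} (a : Vec ℕ (suc m)) where

  lookup-rotR : ∀ t → lookup (rotR a) t ≡ at a (toℕ t + m)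
  lookup-rotR Fin.zero = begin
    last a                ≡⟨ last≡lookup-fromℕ a ⟩
    lookup a (fromℕ m)    ≡⟨ at-toℕ a (fromℕ m) ⟨
    at a (toℕ (fromℕ m))  ≡⟨ cong (at a) (toℕ-fromℕ m) ⟩
    at a m                ∎
    where open ≡-Reasoning
  lookup-rotR (Fin.suc j) = begin
    lookup (init a) j       ≡⟨ lookup-init a j ⟩
    lookup a (inject₁ j)    ≡⟨ at-toℕ a (inject₁ j) ⟨
    at a (toℕ (inject₁ j))  ≡⟨ cong (at a) (toℕ-inject₁ j) ⟩
    at a (toℕ j)            ≡⟨ at-+-period a (toℕ j) ⟨
    at a (toℕ j + suc m)    ≡⟨ cong (at a) (+-suc (toℕ j) m) ⟩
    at a (suc (toℕ j) + m)  ∎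
    where open ≡-Reasoning

  at-rotR : ∀ p → at (rotR a) p ≡ at a (p + m)
  at-rotR p = begin
    at (rotR a) p                  ≡⟨ lookup-rotR (fromℕ< p%n<n) ⟩
    at a (toℕ (fromℕ< p%n<n) + m)  ≡⟨ cong (λ r → at a (r + m)) (toℕ-fromℕ< p%n<n) ⟩
    at a (p % suc m + m)           ≡⟨ at-%-+ a p m ⟩
    at a (p + m)                   ∎
    where
    open ≡-Reasoning
    p%n<n = m%n<n p (suc m)

SigmaAt : (k : ℕ) → Vec ℕ (len k) → ℕ → Set
SigmaAt k a p =
    (at a p ≡ 0 → at a (p + (k + 1)) ≡ 1)
  × (at a p ≡ 1 → (at a (p + 2 * k) ≡ 0) ⊎ (at a (p + k) ≡ 0))
  × (at a p > 1 → at a (p + 2 * k) ≡ at a p ∸ 1)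

SigmaAt-transport : ∀ k (a b : Vec ℕ (len k)) p q →
                    (∀ o → at b (p + o) ≡ at a (q + o)) → SigmaAt k a q → SigmaAt k b p
SigmaAt-transport k a b p q b≗a (rule₀ , rule₁ , rule₊) =
  (λ b≡0 → trans (b≗a (k + 1)) (rule₀ (trans (sym b≡a) b≡0))) ,
  (λ b≡1 → ⊎-map (trans (b≗a (2 * k))) (trans (b≗a k)) (rule₁ (trans (sym b≡a) b≡1))) ,
  (λ b>1 → trans (b≗a (2 * k)) (trans (rule₊ (subst (1 <_) b≡a b>1)) (cong (_∸ 1) (sym b≡a))))
  where
  b≡a : at b p ≡ at a q
  b≡a = subst₂ (λ p′ q′ → at b p′ ≡ at a q′) (+-identityʳ p) (+-identityʳ q) (b≗a 0)

IsSigma⇒SigmaAt : ∀ {k} {a : Vec ℕ (len k)} → IsSigma k a → ∀ p → SigmaAt k a p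
IsSigma⇒SigmaAt {k} {a} (local , _) p =
  SigmaAt-transport k a a p (toℕ (fromℕ< p%n<n)) a≗a (local (fromℕ< p%n<n))
  where
  p%n<n = m%n<n p (len k)
  a≗a : ∀ o → at a (p + o) ≡ at a (toℕ (fromℕ< p%n<n) + o)
  a≗a o rewrite toℕ-fromℕ< p%n<n = sym (at-%-+ a p o)

IsSigma-rotR : ∀ {k} {a : Vec ℕ (len k)} → IsSigma k a → IsSigma k (rotR a)
IsSigma-rotR {k} {a} σ@(_ , zeros≤3) =
  (λ i → SigmaAt-transport k a (rotR a) (toℕ i) (toℕ i + 2 * k) (rotR≗a (toℕ i))
           (IsSigma⇒SigmaAt {k} {a} σ (toℕ i + 2 * k))) ,
  subst (_≤ 3) (sym (zeros-rotR a)) zeros≤3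
  where
  rotR≗a : ∀ p o → at (rotR a) (p + o) ≡ at a (p + 2 * k + o)
  rotR≗a p o = trans (at-rotR a (p + o)) (cong (at a) (xy∙z≈xz∙y p o (2 * k)))

head-rotR : ∀ {k} (a : Vec ℕ (len k)) → IsSigma k a → 1 < head a →
            head (rotR a) ≡ head a ∸ 1
head-rotR a@(_ ∷ _) (local , _) = trans (lookup-rotR a Fin.zero) ∘ proj₂ (proj₂ (local Fin.zero))

-- base is the witness of the header started from its second term.  Condition (ii)
-- holds because z₁ + k + 1 = u and z₂ + k + 1 = n ≡ 0 are where base restarts at 1.
module Witness (c d : ℕ) where

  k : ℕ
  k = 2 + c + d

  z₁ z₂ u : ℕ
  z₁ = suc d
  z₂ = k
  u  = z₁ + suc k

  term : ℕ → ℕ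
  term zero = 1
  term (suc p) with suc p ≟ z₁ | suc p ≟ z₂ | suc p ≟ u
  ... | yes _ | _     | _     = 0
  ... | no _  | yes _ | _     = 0
  ... | no _  | no _  | yes _ = 1
  ... | no _  | no _  | no _  = suc (term p)

  term-suc : ∀ p → term (suc p) ≡ 0 × (suc p ≡ z₁ ⊎ suc p ≡ z₂)
                 ⊎ term (suc p) ≡ 1 × suc p ≡ u
                 ⊎ term (suc p) ≡ suc (term p)
  term-suc p with suc p ≟ z₁ | suc p ≟ z₂ | suc p ≟ u
  ... | yes at-z₁ | _         | _        = inj₁ (refl , inj₁ at-z₁)
  ... | no _      | yes at-z₂ | _        = inj₁ (refl , inj₂ at-z₂)
  ... | no _      | no _      | yes at-u = inj₂ (inj₁ (refl , at-u))
  ... | no _      | no _      | no _     = inj₂ (inj₂ refl)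

  z₁<z₂ : z₁ < z₂
  z₁<z₂ = s≤s (s≤s (m≤n+m d c))

  z₂<u : z₂ < u
  z₂<u = m≤n+m (suc k) z₁

  z₁<u : z₁ < u
  z₁<u = <-trans z₁<z₂ z₂<u

  u+c≡2k : u + c ≡ 2 * k
  u+c≡2k = eq c d
    where
    eq : ∀ c d → suc d + suc (2 + c + d) + c ≡ 2 * (2 + c + d)
    eq = solve-∀

  u<n : u < len k
  u<n = s≤s (subst (u ≤_) u+c≡2k (m≤m+n u c))

  term-z : ∀ {p} → suc p ≡ z₁ ⊎ suc p ≡ z₂ → term (suc p) ≡ 0
  term-z {p} at-z with suc p ≟ z₁ | suc p ≟ z₂
  ... | yes _  | _      = refl
  ... | no _   | yes _  = refl
  ... | no ≢z₁ | no ≢z₂ = contradiction at-z [ ≢z₁ , ≢z₂ ]′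

  term-u : term u ≡ 1
  term-u with u ≟ z₁ | u ≟ z₂ | u ≟ u
  ... | yes u≡z₁ | _        | _      = contradiction u≡z₁ (>⇒≢ z₁<u)
  ... | no _     | yes u≡z₂ | _      = contradiction u≡z₂ (>⇒≢ z₂<u)
  ... | no _     | no _     | yes _  = refl
  ... | no _     | no _     | no u≢u = contradiction refl u≢u

  term-climb : ∀ {p} → u < suc p → term (suc p) ≡ suc (term p)
  term-climb {p} u<p with suc p ≟ z₁ | suc p ≟ z₂ | suc p ≟ u
  ... | yes refl | _        | _        = contradiction z₁<u (<-asym u<p)
  ... | no _     | yes refl | _        = contradiction z₂<u (<-asym u<p)
  ... | no _     | no _     | yes refl = contradiction u<p (<-irrefl refl)
  ... | no _     | no _     | no _     = refl

  term-u+ : ∀ t → term (u + t) ≡ suc t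
  term-u+ zero    = trans (cong term (+-identityʳ u)) term-u
  term-u+ (suc t) = begin
    term (u + suc t)      ≡⟨ cong term (+-suc u t) ⟩
    term (suc (u + t))    ≡⟨ term-climb (s≤s (m≤m+n u t)) ⟩
    suc (term (u + t))    ≡⟨ cong suc (term-u+ t) ⟩
    suc (suc t)           ∎
    where open ≡-Reasoning

  term≡0⇒ : ∀ p → term p ≡ 0 → p ≡ z₁ ⊎ p ≡ z₂
  term≡0⇒ (suc p) term≡0 with term-suc p
  ... | inj₁ (_ , at-z)          = at-z
  ... | inj₂ (inj₁ (term≡1 , _)) = contradiction (trans (sym term≡1) term≡0) λ ()
  ... | inj₂ (inj₂ term≡1+)      = contradiction (trans (sym term≡1+) term≡0) λ ()

  term≤1+ : ∀ p → term p ≤ suc p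
  term≤1+ zero = s≤s z≤n
  term≤1+ (suc p) with term-suc p
  ... | inj₁ (term≡0 , _)        rewrite term≡0  = z≤n
  ... | inj₂ (inj₁ (term≡1 , _)) rewrite term≡1  = s≤s z≤n
  ... | inj₂ (inj₂ term≡1+)      rewrite term≡1+ = s≤s (term≤1+ p)

  base : Vec ℕ (len k)
  base = tabulate (term ∘ toℕ)

  at-base : ∀ {p} → p < len k → at base p ≡ term p
  at-base {p} p<n = begin
    at base p                   ≡⟨ lookup∘tabulate (term ∘ toℕ) (fromℕ< p%n<n) ⟩
    term (toℕ (fromℕ< p%n<n))   ≡⟨ cong term (toℕ-fromℕ< p%n<n) ⟩
    term (p % len k)            ≡⟨ cong term (m<n⇒m%n≡m p<n) ⟩
    term p                      ∎
    where
    open ≡-Reasoning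
    p%n<n = m%n<n p (len k)

  at-base-pred : ∀ q → suc q < len k → at base (suc q + 2 * k) ≡ term q
  at-base-pred q 1+q<n = begin
    at base (suc q + 2 * k)  ≡⟨ cong (at base) (+-suc q (2 * k)) ⟨
    at base (q + len k)      ≡⟨ at-+-period base q ⟩
    at base q                ≡⟨ at-base (<-trans (n<1+n q) 1+q<n) ⟩
    term q                   ∎
    where open ≡-Reasoning

  rule-zero : ∀ p → term p ≡ 0 → at base (p + (k + 1)) ≡ 1
  rule-zero p term≡0 with term≡0⇒ p term≡0
  ... | inj₁ refl = begin
    at base (z₁ + (k + 1))  ≡⟨ cong (λ x → at base (z₁ + x)) (+-comm k 1) ⟩
    at base u               ≡⟨ at-base u<n ⟩
    term u                  ≡⟨ term-u ⟩
    1                       ∎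
    where open ≡-Reasoning
  ... | inj₂ refl = begin
    at base (k + (k + 1))   ≡⟨ cong (at base) (eq k) ⟩
    at base (0 + len k)     ≡⟨ at-+-period base 0 ⟩
    1                       ∎
    where
    open ≡-Reasoning
    eq : ∀ k → k + (k + 1) ≡ suc (2 * k)
    eq = solve-∀

  rule-one : ∀ p → p < len k → term p ≡ 1 → at base (p + 2 * k) ≡ 0 ⊎ at base (p + k) ≡ 0
  rule-one zero    _     _      = inj₂ (trans (at-base (<-trans z₂<u u<n)) (term-z (inj₂ refl)))
  rule-one (suc q) 1+q<n term≡1 with term-suc q
  ... | inj₁ (term≡0 , _)       = contradiction (trans (sym term≡0) term≡1) λ ()
  ... | inj₂ (inj₁ (_ , refl))  = inj₂ (begin
    at base (u + k)         ≡⟨ cong (at base) (eq z₁ k) ⟩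
    at base (z₁ + len k)    ≡⟨ at-+-period base z₁ ⟩
    at base z₁              ≡⟨ at-base (<-trans z₁<u u<n) ⟩
    term z₁                 ≡⟨ term-z (inj₁ refl) ⟩
    0                       ∎)
    where
    open ≡-Reasoning
    eq : ∀ z k → z + suc k + k ≡ z + suc (2 * k)
    eq = solve-∀
  ... | inj₂ (inj₂ term≡1+)     =
    inj₁ (trans (at-base-pred q 1+q<n) (suc-injective (trans (sym term≡1+) term≡1)))

  rule-climb : ∀ p → p < len k → 1 < term p → at base (p + 2 * k) ≡ term p ∸ 1
  rule-climb zero    _     (s≤s ())
  rule-climb (suc q) 1+q<n 1<term with term-suc q
  ... | inj₁ (term≡0 , _)        = contradiction (subst (1 <_) term≡0 1<term) λ ()
  ... | inj₂ (inj₁ (term≡1 , _)) = contradiction (subst (1 <_) term≡1 1<term) (<-irrefl refl)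
  ... | inj₂ (inj₂ term≡1+) rewrite term≡1+ = at-base-pred q 1+q<n

  base-IsSigma : IsSigma k base
  base-IsSigma = (λ i → SigmaAt-base (toℕ i) (toℕ<n i)) , ≤-trans zeros≤2 (n≤1+n 2)
    where
    SigmaAt-base : ∀ p → p < len k → SigmaAt k base p
    SigmaAt-base p p<n =
      (λ base≡0 → rule-zero p (trans (sym (at-base p<n)) base≡0)) ,
      (λ base≡1 → rule-one p p<n (trans (sym (at-base p<n)) base≡1)) ,
      (λ 1<base → trans (rule-climb p p<n (subst (1 <_) (at-base p<n) 1<base))
                        (cong (_∸ 1) (sym (at-base p<n))))
    zeros≤2 : zeros base ≤ 2
    zeros≤2 = zeros-tabulate-≤ {len k} term (z₁ ∷ z₂ ∷ []) λ p term≡0 →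
      [ (λ { refl → here refl }) , (λ { refl → there (here refl) }) ]′ (term≡0⇒ p term≡0)

  base-bounded : All (_< suc (len k)) base
  base-bounded = All-tabulate⁺ (λ i → s≤s (≤-trans (term≤1+ (toℕ i)) (toℕ<n i)))

  witness : Vec ℕ (len k)
  witness = rotR base

  witness-head : head witness ≡ suc c
  witness-head = begin
    head (rotR base)   ≡⟨ lookup-rotR base Fin.zero ⟩
    at base (2 * k)    ≡⟨ at-base (n<1+n (2 * k)) ⟩
    term (2 * k)       ≡⟨ cong term u+c≡2k ⟨
    term (u + c)       ≡⟨ term-u+ c ⟩
    suc c              ∎
    where open ≡-Reasoning

  witness-second : head (tail witness) ≡ 1
  witness-second = refl

sigmaSeqs : (j k : ℕ) → List (Vec ℕ (len k))
sigmaSeqs j k = filter (λ a → isSigma? k a ×-dec (head a ≟ j)) (vecsBelow (suc (len k)) (len k))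

module _ (j k : ℕ) where

  sigmaSeqs-unique : Unique (sigmaSeqs j k)
  sigmaSeqs-unique = filter⁺ _ (vecsBelow-unique (suc (len k)) (len k))

  ∈-sigmaSeqs⁺ : ∀ {a} → All (_< suc (len k)) a → IsSigma k a → head a ≡ j →
                 a ∈ sigmaSeqs j k
  ∈-sigmaSeqs⁺ bounded σ head≡j =
    ∈-filter⁺ (λ a → isSigma? k a ×-dec (head a ≟ j)) (∈-vecsBelow⁺ bounded) (σ , head≡j)

  ∈-sigmaSeqs⁻ : ∀ {a} → a ∈ sigmaSeqs j k →
                 All (_< suc (len k)) a × IsSigma k a × head a ≡ j
  ∈-sigmaSeqs⁻ a∈
    with a∈vecs , σ , head≡j ← ∈-filter⁻ (λ a → isSigma? k a ×-dec (head a ≟ j)) a∈ =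
    ∈-vecsBelow⁻ a∈vecs , σ , head≡j

rotR-∈-sigmaSeqs : ∀ j k {a} → a ∈ sigmaSeqs (suc (suc j)) k → rotR a ∈ sigmaSeqs (suc j) k
rotR-∈-sigmaSeqs j k {a} a∈ with bounded , σ , head≡ ← ∈-sigmaSeqs⁻ (suc (suc j)) k a∈ =
  ∈-sigmaSeqs⁺ (suc j) k (All-rotR bounded) (IsSigma-rotR {k} {a} σ)
    (trans (head-rotR {k} a σ (subst (1 <_) (sym head≡) (s≤s (s≤s z≤n)))) (cong (_∸ 1) head≡))

sigmaCount-< : ∀ c d → sigmaCount (2 + c) (2 + c + d) < sigmaCount (1 + c) (2 + c + d)
sigmaCount-< c d = length-<-injection rotR rotR-injective (sigmaSeqs-unique (2 + c) k)
  (rotR-∈-sigmaSeqs c k) witness∈ rotR≢witness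
  where
  open Witness c d
  witness∈ : witness ∈ sigmaSeqs (1 + c) k
  witness∈ = ∈-sigmaSeqs⁺ (1 + c) k (All-rotR base-bounded)
                (IsSigma-rotR {k} {base} base-IsSigma) witness-head
  rotR≢witness : ∀ {a} → a ∈ sigmaSeqs (2 + c) k → rotR a ≢ witness
  rotR≢witness {a} a∈ rotR≡ = contradiction 2+c≡1 λ ()
    where
    open ≡-Reasoning
    2+c≡1 : 2 + c ≡ 1
    2+c≡1 = begin
      2 + c                 ≡⟨ proj₂ (proj₂ (∈-sigmaSeqs⁻ (2 + c) k a∈)) ⟨
      head a                ≡⟨ head-init a ⟨
      head (tail (rotR a))  ≡⟨ cong (head ∘ tail) rotR≡ ⟩
      head (tail witness)   ≡⟨ witness-second ⟩
      1                     ∎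

mainTheorem20 : (k : ℕ) → 1 ≤ k → (i : ℕ) → 1 < i → i ≤ k →
    sigmaCount i k < sigmaCount (i ∸ 1) k
mainTheorem20 k _ (suc (suc c)) (s≤s (s≤s z≤n)) i≤k
  with d , refl ← m≤n⇒∃[o]m+o≡n i≤k = sigmaCount-< c d
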